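{- For any $\phi,\psi\in \mathrm{PL}(\mathrm{NE}^*,\veebar)$, there is a $\theta\in \mathrm{PL}(\mathrm{NE}^*,\veebar)$ such that $\phi\equiv \theta$ and $\psi\equiv \neg \theta$.
   Context: $\mathrm{PL}(\mathrm{NE}^*,\veebar)$: $\phi ::= p \mid \bot \mid \neg\phi \mid \phi\wedge\phi \mid \phi\vee\phi \mid \mathrm{NE}^* \mid \phi\veebar\phi$, on propositional teams with support $\models$ / anti-support $\models^-$: $p$ supported iff all $w\in s$ make $p$ true, anti-supported iff none do; $s\models\bot$ iff $s=\emptyset$, $\bot$ always anti-supported; $s\models\mathrm{NE}^*$ iff $s\ne\emptyset$ and also $s\models^-\mathrm{NE}^*$ iff $s\ne\emptyset$; $\neg$ swaps support and anti-support; $\wedge$ supported iff both conjuncts are, anti-supported iff $s=t\cup u$ with $t\models^-\phi,u\models^-\psi$; $\vee$ supported iff $s=t\cup u$ with $t\models\phi,u\models\psi$, anti-supported iff both are; $\veebar$ (global disjunction) supported iff one disjunct is, anti-supported iff both are. $\equiv$ is equivalence of support. -}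

module Defs where

open import Data.Nat using (ℕ)
open import Data.Fin using (Fin)
open import Data.Bool using (Bool; true; false; _∨_)
open import Data.Vec using (Vec; lookup)
open import Data.Product using (_×_; ∃; ∃-syntax)
open import Data.Sum using (_⊎_)
open import Data.Unit using (⊤)
open import Relation.Binary.PropositionalEquality using (_≡_)

data Form (n : ℕ) : Set where
  var  : Fin n → Form n
  ⊥f   : Form n
  ¬f_  : Form n → Form n
  _∧f_ : Form n → Form n → Form n
  _∨f_ : Form n → Form n → Form n
  NE*  : Form n
  _⊻_  : Form n → Form n → Form n

Val : ℕ → Set
Val n = Vec Bool n

Team : ℕ → Set
Team n = Val n → Bool

_≐_∪_ : {n : ℕ} → Team n → Team n → Team n → Set
s ≐ t ∪ u = ∀ w → s w ≡ (t w ∨ u w)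

Empty : {n : ℕ} → Team n → Set
Empty s = ∀ w → s w ≡ false

NonEmpty : {n : ℕ} → Team n → Set
NonEmpty s = ∃[ w ] (s w ≡ true)

infix 4 _⊨_ _⊨⁻_

mutual
  _⊨_ : {n : ℕ} → Team n → Form n → Set
  s ⊨ var p   = ∀ w → s w ≡ true → lookup w p ≡ true
  s ⊨ ⊥f      = Empty s
  s ⊨ (¬f φ)  = s ⊨⁻ φ
  s ⊨ (φ ∧f ψ) = (s ⊨ φ) × (s ⊨ ψ)
  s ⊨ (φ ∨f ψ) = ∃[ t ] ∃[ u ] ((s ≐ t ∪ u) × (t ⊨ φ) × (u ⊨ ψ))
  s ⊨ NE*     = NonEmpty s
  s ⊨ (φ ⊻ ψ) = (s ⊨ φ) ⊎ (s ⊨ ψ)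

  _⊨⁻_ : {n : ℕ} → Team n → Form n → Set
  s ⊨⁻ var p   = ∀ w → s w ≡ true → lookup w p ≡ false
  s ⊨⁻ ⊥f      = ⊤
  s ⊨⁻ (¬f φ)  = s ⊨ φ
  s ⊨⁻ (φ ∧f ψ) = ∃[ t ] ∃[ u ] ((s ≐ t ∪ u) × (t ⊨⁻ φ) × (u ⊨⁻ ψ))
  s ⊨⁻ (φ ∨f ψ) = (s ⊨⁻ φ) × (s ⊨⁻ ψ)
  s ⊨⁻ NE*     = NonEmpty s
  s ⊨⁻ (φ ⊻ ψ) = (s ⊨⁻ φ) × (s ⊨⁻ ψ)

_≡ᶠ_ : {n : ℕ} → Form n → Form n → Set
φ ≡ᶠ ψ = ∀ s → ((s ⊨ φ) → (s ⊨ ψ)) × ((s ⊨ ψ) → (s ⊨ φ))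

{-# OPTIONS --safe #-}
-- The two halves of a global disjunction θ ⊻ θ' are independent: it is supported iff
-- one disjunct is, and anti-supported iff both are.  So take θ = ⌈φ⌉ ⊻ ¬⌊ψ⌋, where ⌈φ⌉
-- is supported exactly like φ and anti-supported by every team, and ⌊ψ⌋ is supported
-- exactly like ψ and anti-supported by no team.  Both are obtained from φ and ψ by
-- global disjunctions with a formula taut supported and anti-supported by every team
-- and a formula contra supported and anti-supported by none.  Constructing taut uses that
-- every team is empty or nonempty, which holds constructively because teams are decidable
-- sets of valuations over finitely many variables.
module Submission where

open import Defs
open import Data.Nat using (ℕ; zero; suc)
open import Data.Product using (_×_; ∃-syntax; _,_)
open import Data.Sum using (_⊎_; inj₁; inj₂)
open import Data.Unit using (tt)
open import Data.Empty using (⊥-elim)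
open import Data.Bool using (true; false; _∨_)
open import Data.Bool.Properties using (∨-zeroʳ)
open import Data.Vec using ([]; _∷_)
open import Relation.Binary.PropositionalEquality using (sym; trans; cong)
open import Relation.Nullary using (¬_)

private
  variable
    n : ℕ

empty⊎nonEmpty : (s : Team n) → Empty s ⊎ NonEmpty s
empty⊎nonEmpty {zero} s with s [] in eq
... | true  = inj₂ ([] , eq)
... | false = inj₁ λ { [] → eq }
empty⊎nonEmpty {suc n} s
  with empty⊎nonEmpty (λ w → s (true ∷ w)) | empty⊎nonEmpty (λ w → s (false ∷ w))
... | inj₂ (w , sw) | _             = inj₂ (true ∷ w , sw)
... | inj₁ _        | inj₂ (w , sw) = inj₂ (false ∷ w , sw)
... | inj₁ e₁       | inj₁ e₂       = inj₁ λ { (true ∷ w) → e₁ w ; (false ∷ w) → e₂ w }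

taut : Form n
taut = (¬f (⊥f ⊻ NE*)) ⊻ ⊥f

taut-supported : (s : Team n) → s ⊨ taut
taut-supported s with empty⊎nonEmpty s
... | inj₁ empty    = inj₂ empty
... | inj₂ nonEmpty = inj₁ (tt , nonEmpty)

taut-antiSupported : (s : Team n) → s ⊨⁻ taut
taut-antiSupported s = empty⊎nonEmpty s , tt

contra : Form n
contra = (¬f ⊥f) ∨f (⊥f ∧f NE*)

contra-unsupported : (s : Team n) → ¬ (s ⊨ contra)
contra-unsupported s (t , u , _ , _ , u-empty , w , uw) with trans (sym uw) (u-empty w)
... | ()

-- s would be empty yet contain the witness of some nonempty part of it.
contra-unantisupported : (s : Team n) → ¬ (s ⊨⁻ contra)
contra-unantisupported s (s-empty , t , u , s≐t∪u , _ , w , uw)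
  with trans (sym (s-empty w)) (trans (s≐t∪u w) (trans (cong (t w ∨_) uw) (∨-zeroʳ (t w))))
... | ()

⌈_⌉ : Form n → Form n
⌈ φ ⌉ = ¬f ((¬f φ) ⊻ (¬f taut))

⌈⌉-≡ᶠ : (φ : Form n) → φ ≡ᶠ ⌈ φ ⌉
⌈⌉-≡ᶠ φ s = (λ sφ → sφ , taut-supported s) , λ { (sφ , _) → sφ }

⌈⌉-antiSupported : (φ : Form n) (s : Team n) → s ⊨⁻ ⌈ φ ⌉
⌈⌉-antiSupported φ s = inj₂ (taut-antiSupported s)

⌊_⌋ : Form n → Form n
⌊ ψ ⌋ = ψ ⊻ contra

⌊⌋-≡ᶠ : (ψ : Form n) → ψ ≡ᶠ ⌊ ψ ⌋
⌊⌋-≡ᶠ ψ s = inj₁ , λ { (inj₁ sψ) → sψ ; (inj₂ sc) → ⊥-elim (contra-unsupported s sc) }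

⌊⌋-unantisupported : (ψ : Form n) (s : Team n) → ¬ (s ⊨⁻ ⌊ ψ ⌋)
⌊⌋-unantisupported ψ s (_ , sc) = contra-unantisupported s sc

withAntiSupport : Form n → Form n → Form n
withAntiSupport φ ψ = ⌈ φ ⌉ ⊻ (¬f ⌊ ψ ⌋)

withAntiSupport-support : (φ ψ : Form n) → φ ≡ᶠ withAntiSupport φ ψ
withAntiSupport-support φ ψ s with ⌈⌉-≡ᶠ φ s
... | to , from = (λ sφ → inj₁ (to sφ))
                , λ { (inj₁ s⌈φ⌉) → from s⌈φ⌉
                    ; (inj₂ s¬⌊ψ⌋) → ⊥-elim (⌊⌋-unantisupported ψ s s¬⌊ψ⌋) }

withAntiSupport-antiSupport : (φ ψ : Form n) → ψ ≡ᶠ (¬f withAntiSupport φ ψ)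
withAntiSupport-antiSupport φ ψ s with ⌊⌋-≡ᶠ ψ s
... | to , from = (λ sψ → ⌈⌉-antiSupported φ s , to sψ) , λ { (_ , s⌊ψ⌋) → from s⌊ψ⌋ }

theorem3p25 : (n : ℕ) (φ ψ : Form n) → ∃[ θ ] ((φ ≡ᶠ θ) × (ψ ≡ᶠ (¬f θ)))
theorem3p25 n φ ψ =
  withAntiSupport φ ψ , withAntiSupport-support φ ψ , withAntiSupport-antiSupport φ ψ
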